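{- Let $T$ be an in-star (a centre vertex $c$ with arcs $\ell_i\to c$ from its leaves) carrying a \textsc{blocking pebbles} position with only blue and red pebbles. Let $b_c\ge0$ be the number of blue pebbles on $c$, $b_\ell\ge 0$ the total number of blue pebbles on the leaves, and define $r_c,r_\ell$ similarly for red. Then: (1) if some leaves carry at least one blue pebble in total, the centre carries at least one blue pebble, and there are no red pebbles anywhere, the game value of $T$ is $3b_c+2b_\ell-2$. For the in-star with exactly two leaves $\ell_1,\ell_2$, write $[(x,y),[p,q],[s,t]]$ for the position with $x$ blue and $y$ red pebbles on $c$, $p$ blue and $q$ red on $\ell_1$, and $s$ blue and $t$ red on $\ell_2$. Then: (2) $[(0,0),[0,1],[1,0]]$ has value $0$ and $[(0,0),[0,2],[2,0]]$ has value $*$; (3) for $a\ge 2$, $[(0,0),[a,0],[0,1]]$ has value $2a-2$; (4) for $a\ge 3$, $[(0,0),[a,0],[0,2]]$ has value $\{2a-6\mid 0\}$; (5) for $a,b\ge 3$, $[(0,0),[a,0],[0,b]]$ has value $\{2a-6\mid -2b+6\}$; (6) for $a,b\ge 1$ and $c\ge 2$, $[(a,0),[b,0],[0,c]]$ has value $3a+2b-5$.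
   Context: \textsc{Blocking pebbles}: a position is a finite directed acyclic graph with, at each vertex, numbers of blue, red and green pebbles (here no green pebbles). An in-neighbour of $v$ is $u$ with an arc $u\to v$; an out-neighbour is $w$ with an arc $v\to w$. Left, from a chosen vertex $v$, either (1) moves a positive number of her pebbles (blue or green) from $v$ to a single in-neighbour of $v$ at no cost, or (2) removes two of her pebbles from $v$ and places one pebble on an out-neighbour of $v$. No blue pebble may be moved onto a vertex currently carrying a red pebble. Right has the symmetric moves with red (and green) pebbles, and no red pebble may be moved onto a vertex carrying a blue pebble. Normal play (last player to move wins). Values are combinatorial game values in Conway's sense; $*=\{0\mid0\}$. -}

module Defs where

open import Data.Nat using (ℕ; zero; suc; _+_; _*_; _∸_; _≤_)
open import Data.Nat.Properties using ()
open import Data.Fin using (Fin; zero; suc; _≟_)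
open import Data.List using (List; []; _∷_; [_]; map; allFin)
open import Data.Nat.ListAction using (sum)
open import Data.List.Membership.Propositional using (_∈_)
open import Data.Integer using (ℤ; +_; -[1+_])
open import Data.Product using (_×_; Σ)
open import Relation.Binary.PropositionalEquality using (_≡_)
open import Relation.Nullary using (does)
open import Data.Bool using (if_then_else_)

data Game : Set where
  ⟨_∣_⟩ : List Game → List Game → Game

-- An arena: a type of positions with left / right option relations.
-- (x ⟶L y means: y is a Left option of x.)
record Arena : Set₁ where
  field
    Pos  : Set
    _⟶L_ : Pos → Pos → Set
    _⟶R_ : Pos → Pos → Set
open Arena public

-- Conway's order between positions of two (well-founded) arenas,
-- defined inductively together with the "less or confused" relation ⧏:
--   x ≤ y  iff  every Left option xL of x satisfies xL ⧏ y  and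
--              every Right option yR of y satisfies x ⧏ yR;
--   x ⧏ y  iff  x ≤ yL for some Left option yL of y, or
--              xR ≤ y for some Right option xR of x.
-- (For well-founded games x ⧏ y is equivalent to ¬ (y ≤ x).)
module Compare (A B : Arena) where
  mutual
    data _≤G_ (x : Pos A) (y : Pos B) : Set where
      le : (∀ x' → _⟶L_ A x x' → x' ⧏ y)
         → (∀ y' → _⟶R_ B y y' → x ⧏ y')
         → x ≤G y

    data _⧏_ (x : Pos A) (y : Pos B) : Set where
      lfL : ∀ y' → _⟶L_ B y y' → x ≤G y' → x ⧏ y
      lfR : ∀ x' → _⟶R_ A x x' → x' ≤G y → x ⧏ y

Equiv : (A B : Arena) → Pos A → Pos B → Set
Equiv A B x y = Compare._≤G_ A B x y × Compare._≤G_ B A y x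

GameArena : Arena
GameArena = record
  { Pos  = Game
  ; _⟶L_ = λ { ⟨ ls ∣ rs ⟩ g → g ∈ ls }
  ; _⟶R_ = λ { ⟨ ls ∣ rs ⟩ g → g ∈ rs }
  }

intGame : ℤ → Game
intGame (+ zero)        = ⟨ [] ∣ [] ⟩
intGame (+ suc n)       = ⟨ [ intGame (+ n) ] ∣ [] ⟩
intGame (-[1+ zero ])   = ⟨ [] ∣ [ ⟨ [] ∣ [] ⟩ ] ⟩
intGame (-[1+ suc n ])  = ⟨ [] ∣ [ intGame -[1+ n ] ] ⟩

star : Game
star = ⟨ [ intGame (+ 0) ] ∣ [ intGame (+ 0) ] ⟩

Digraph : ℕ → Set₁
Digraph n = Fin n → Fin n → Set     -- G u v : there is an arc u → v

record Pebbles (n : ℕ) : Set where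
  constructor pebbles
  field
    blue : Fin n → ℕ
    red  : Fin n → ℕ
open Pebbles public

adjust : ∀ {n} → (Fin n → ℕ) → Fin n → (ℕ → ℕ) → Fin n → ℕ
adjust f v g i = if does (i Data.Fin.≟ v) then g (f i) else f i

data LeftMove {n} (G : Digraph n) : Pebbles n → Pebbles n → Set where
  slide : ∀ p v u k → G u v → 1 ≤ k → k ≤ blue p v → red p u ≡ 0 →
          LeftMove G p (pebbles (adjust (adjust (blue p) v (_∸ k)) u (_+ k)) (red p))
  jump  : ∀ p v w → G v w → 2 ≤ blue p v → red p w ≡ 0 →
          LeftMove G p (pebbles (adjust (adjust (blue p) v (_∸ 2)) w suc) (red p))

data RightMove {n} (G : Digraph n) : Pebbles n → Pebbles n → Set where
  slide : ∀ p v u k → G u v → 1 ≤ k → k ≤ red p v → blue p u ≡ 0 →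
          RightMove G p (pebbles (blue p) (adjust (adjust (red p) v (_∸ k)) u (_+ k)))
  jump  : ∀ p v w → G v w → 2 ≤ red p v → blue p w ≡ 0 →
          RightMove G p (pebbles (blue p) (adjust (adjust (red p) v (_∸ 2)) w suc))

PebbleArena : ∀ {n} → Digraph n → Arena
PebbleArena {n} G = record
  { Pos = Pebbles n ; _⟶L_ = LeftMove G ; _⟶R_ = RightMove G }

HasValue : ∀ {n} (G : Digraph n) → Pebbles n → Game → Set
HasValue G p g = Equiv (PebbleArena G) GameArena p g

-- In-star with k leaves: vertex zero is the centre c, vertices suc i
-- are the leaves ℓ_i, with arcs ℓ_i → c.

data InStar (k : ℕ) : Fin (suc k) → Fin (suc k) → Set where
  leaf→centre : ∀ (i : Fin k) → InStar k (suc i) zero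

leafBlue : ∀ {k} → Pebbles (suc k) → ℕ
leafBlue {k} p = sum (map (λ i → blue p (suc i)) (allFin k))

leafRed : ∀ {k} → Pebbles (suc k) → ℕ
leafRed {k} p = sum (map (λ i → red p (suc i)) (allFin k))

pos2 : ℕ → ℕ → ℕ → ℕ → ℕ → ℕ → Pebbles 3
pos2 x y p q s t = pebbles b r
  where
    b : Fin 3 → ℕ
    b zero             = x
    b (suc zero)       = p
    b (suc (suc zero)) = s
    r : Fin 3 → ℕ
    r zero             = y
    r (suc zero)       = q
    r (suc (suc zero)) = t

-- Give a blue pebble weight 3 on the centre and 2 on a leaf. In the positions studied Right has no
-- move, every Left move lowers the weight, and while the weight exceeds a threshold c Left can lower
-- it by exactly one (a jump, or sliding one pebble off the centre); such a position is the integer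
-- weight − c. The threshold is 2 on a red-free in-star, where Left spends all but one leaf pebble, and
-- 5 when a red pair waits on the other leaf: once the centre is empty Right jumps in and freezes Left,
-- so Left keeps one pebble on the centre and one on the leaf. Positions dominated by red pebbles are
-- mirror images (colours and leaves swapped) of blue ones and take the negated values, and in the
-- remaining two-leaf positions each player has a single jump, onto such integer positions.

module Submission where

open import Defs
open import Data.Nat using (ℕ; _+_; _*_; _≤_)
open import Data.Fin using (Fin; zero)
open import Data.Integer using (ℤ; +_) renaming (_+_ to _+ℤ_; _*_ to _*ℤ_; _-_ to _-ℤ_; -_ to -ℤ_)
open import Data.List using ([_])
open import Data.Product using (_×_)
open import Relation.Binary.PropositionalEquality using (_≡_)

open import Data.Empty using (⊥-elim)
open import Data.Fin using (suc; _≟_; punchIn)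
open import Data.Fin.Patterns using (0F; 1F; 2F)
open import Data.Fin.Properties using (punchInᵢ≢i; any?) renaming (suc-injective to Fin-suc-injective)
open import Data.Integer.Properties using (pos-*; pos-+; m-n≡m⊖n; ⊖-≥; -m+n≡n⊖m; ⊖-≤)
open import Data.List using (map; allFin; tabulate)
open import Data.List.Properties using (map-tabulate)
open import Data.List.Relation.Unary.Any using (here)
open import Data.Nat using (zero; suc; _∸_; _<_; z≤n; s≤s; _≤?_)
open import Data.Nat.ListAction using (sum)
open import Data.Nat.Properties
  using ( +-0-commutativeMonoid; +-comm; +-suc; +-identityʳ; +-mono-≤; +-monoˡ-≤; *-monoʳ-≤
        ; ≤-trans; ≤-reflexive; ≤-pred; <-≤-trans; ≤⇒≯; ≰⇒>; n<1⇒n≡0; n≤1+n; suc-injective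
        ; m≤m+n; m≤n+m; m<n+m; m∸n+n≡m; m+[n∸m]≡n; m+n∸m≡n )
open import Data.Nat.Tactic.RingSolver using (solve-∀)
open import Algebra.Properties.CommutativeMonoid.Sum +-0-commutativeMonoid
  using (sum-remove; sum-cong-≗) renaming (sum to ∑)
open import Data.Product using (∃; _,_; proj₁; proj₂)
open import Data.Sum using (_⊎_; inj₁; inj₂)
open import Data.Unit using (⊤; tt)
open import Function using (_∘_; id)
open import Relation.Binary.PropositionalEquality
  using (_≢_; refl; sym; trans; cong; cong₂; subst; subst₂; module ≡-Reasoning)
open import Relation.Nullary using (¬_; yes; no; contradiction)
open import Relation.Nullary.Decidable using (dec-true; dec-false)

Swap : Arena → Arena
Swap A = record { Pos = Pos A ; _⟶L_ = _⟶R_ A ; _⟶R_ = _⟶L_ A }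

module _ {A B : Arena} where
  private
    module AB = Compare A B
    module BA = Compare (Swap B) (Swap A)

  mutual
    swap-≤ : ∀ {x y} → x AB.≤G y → y BA.≤G x
    swap-≤ (AB.le left right) = BA.le (λ y' r → swap-⧏ (right y' r)) (λ x' l → swap-⧏ (left x' l))

    swap-⧏ : ∀ {x y} → x AB.⧏ y → y BA.⧏ x
    swap-⧏ (AB.lfL y' l x≤y') = BA.lfR y' l (swap-≤ x≤y')
    swap-⧏ (AB.lfR x' r x'≤y) = BA.lfL x' r (swap-≤ x'≤y)

Equiv-sym : ∀ {A B x y} → Equiv A B x y → Equiv B A y x
Equiv-sym (x≤y , y≤x) = y≤x , x≤y

Equiv-swap : ∀ {A B x y} → Equiv A B x y → Equiv (Swap A) (Swap B) x y
Equiv-swap (x≤y , y≤x) = swap-≤ y≤x , swap-≤ x≤y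

record Bisimulation (A B : Arena) : Set₁ where
  field
    _∼_    : Pos A → Pos B → Set
    forthL : ∀ {a b a'} → a ∼ b → _⟶L_ A a a' → ∃ λ b' → _⟶L_ B b b' × a' ∼ b'
    backL  : ∀ {a b b'} → a ∼ b → _⟶L_ B b b' → ∃ λ a' → _⟶L_ A a a' × a' ∼ b'
    forthR : ∀ {a b a'} → a ∼ b → _⟶R_ A a a' → ∃ λ b' → _⟶R_ B b b' × a' ∼ b'
    backR  : ∀ {a b b'} → a ∼ b → _⟶R_ B b b' → ∃ λ a' → _⟶R_ A a a' × a' ∼ b'

module _ {A B : Arena} (S : Bisimulation A B) {C : Arena} where
  open Bisimulation S
  private
    module AC = Compare A C
    module BC = Compare B C
    module CA = Compare C A
    module CB = Compare C B

  mutual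
    ≤-transportˡ : ∀ {a b c} → a ∼ b → a AC.≤G c → b BC.≤G c
    ≤-transportˡ a∼b (AC.le left right) = BC.le
      (λ b' l → let a' , l' , a'∼b' = backL a∼b l in ⧏-transportˡ a'∼b' (left a' l'))
      (λ c' r → ⧏-transportˡ a∼b (right c' r))

    ⧏-transportˡ : ∀ {a b c} → a ∼ b → a AC.⧏ c → b BC.⧏ c
    ⧏-transportˡ a∼b (AC.lfL c' l a≤c') = BC.lfL c' l (≤-transportˡ a∼b a≤c')
    ⧏-transportˡ a∼b (AC.lfR a' r a'≤c) =
      let b' , r' , a'∼b' = forthR a∼b r in BC.lfR b' r' (≤-transportˡ a'∼b' a'≤c)

    ≤-transportʳ : ∀ {a b c} → a ∼ b → c CA.≤G a → c CB.≤G b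
    ≤-transportʳ a∼b (CA.le left right) = CB.le
      (λ c' l → ⧏-transportʳ a∼b (left c' l))
      (λ b' r → let a' , r' , a'∼b' = backR a∼b r in ⧏-transportʳ a'∼b' (right a' r'))

    ⧏-transportʳ : ∀ {a b c} → a ∼ b → c CA.⧏ a → c CB.⧏ b
    ⧏-transportʳ a∼b (CA.lfL a' l c≤a') =
      let b' , l' , a'∼b' = forthL a∼b l in CB.lfL b' l' (≤-transportʳ a'∼b' c≤a')
    ⧏-transportʳ a∼b (CA.lfR c' r c'≤a) = CB.lfR c' r (≤-transportʳ a∼b c'≤a)

  Equiv-transport : ∀ {a b c} → a ∼ b → Equiv A C a c → Equiv B C b c
  Equiv-transport a∼b (a≤c , c≤a) = ≤-transportˡ a∼b a≤c , ≤-transportʳ a∼b c≤a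

LeftStuck RightStuck : (A : Arena) → Pos A → Set
LeftStuck  A x = ∀ {x'} → ¬ _⟶L_ A x x'
RightStuck A x = ∀ {x'} → ¬ _⟶R_ A x x'

nonnegative-RightStuck : ∀ m → RightStuck GameArena (intGame (+ m))
nonnegative-RightStuck zero    ()
nonnegative-RightStuck (suc m) ()

nonpositive-LeftStuck : ∀ m → LeftStuck GameArena (intGame (-ℤ + m))
nonpositive-LeftStuck zero          ()
nonpositive-LeftStuck (suc zero)    ()
nonpositive-LeftStuck (suc (suc m)) ()

module _ {A : Arena} where
  private
    module AG = Compare A GameArena
    module GA = Compare GameArena A

  LeftStuck⇒≤int : ∀ {x} m → LeftStuck A x → x AG.≤G intGame (+ m)
  LeftStuck⇒≤int m stuck = AG.le (λ _ l → ⊥-elim (stuck l)) (λ _ r → ⊥-elim (nonnegative-RightStuck m r))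

  RightStuck⇒0≤ : ∀ {x} → RightStuck A x → intGame (+ 0) GA.≤G x
  RightStuck⇒0≤ stuck = GA.le (λ _ ()) (λ _ r → ⊥-elim (stuck r))

  unique-options-value : ∀ {x gL gR} →
    (∀ {x'} → _⟶L_ A x x' → Equiv A GameArena x' gL) → ∃ (_⟶L_ A x) →
    (∀ {x'} → _⟶R_ A x x' → Equiv A GameArena x' gR) → ∃ (_⟶R_ A x) →
    Equiv A GameArena x ⟨ [ gL ] ∣ [ gR ] ⟩
  unique-options-value leftValue (xL , l) rightValue (xR , r) =
    AG.le (λ _ l' → AG.lfL _ (here refl) (proj₁ (leftValue l')))
          (λ { _ (here refl) → AG.lfR xR r (proj₁ (rightValue r)) }) ,
    GA.le (λ { _ (here refl) → GA.lfL xL l (proj₂ (leftValue l)) })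
          (λ _ r' → GA.lfR _ (here refl) (proj₂ (rightValue r')))

data Negated : Game → Game → Set where
  negated : ∀ m → Negated (intGame (+ m)) (intGame (-ℤ + m))

negation : Bisimulation (Swap GameArena) GameArena
negation = record
  { _∼_    = Negated
  ; forthL = λ { (negated m) r → ⊥-elim (nonnegative-RightStuck m r) }
  ; backL  = λ { (negated m) l → ⊥-elim (nonpositive-LeftStuck m l) }
  ; forthR = λ { (negated (suc zero))    (here refl) → _ , here refl , negated zero
               ; (negated (suc (suc m))) (here refl) → _ , here refl , negated (suc m) }
  ; backR  = λ { (negated (suc zero))    (here refl) → _ , here refl , negated zero
               ; (negated (suc (suc m))) (here refl) → _ , here refl , negated (suc m) }
  }

negate-value : ∀ {A x} m → Equiv A GameArena x (intGame (+ m)) → Equiv (Swap A) GameArena x (intGame (-ℤ + m))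
negate-value m x≡m = Equiv-sym (Equiv-transport negation (negated m) (Equiv-sym (Equiv-swap x≡m)))

DescendingOption : (A : Arena) → (Pos A → ℕ) → ℕ → (Pos A → Set) → Pos A → Pos A → Set
DescendingOption A weight c Q x x' =
  (Q x' × weight x' < weight x × c ≤ weight x') ⊎ ∃ λ x'' → _⟶R_ A x' x'' × LeftStuck A x''

module _ {A : Arena} (weight : Pos A → ℕ) (c : ℕ) {Q : Pos A → Set} where
  private
    module AG = Compare A GameArena
    module GA = Compare GameArena A

  module _ (leftMove : ∀ {x x'} → Q x → _⟶L_ A x x' → DescendingOption A weight c Q x x') where
    mutual
      ≤int-byWeight : ∀ m {x} → Q x → weight x ≤ c + m → x AG.≤G intGame (+ m)
      ≤int-byWeight m q bound =
        AG.le (λ _ l → option⧏int m bound (leftMove q l)) (λ _ r → ⊥-elim (nonnegative-RightStuck m r))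

      option⧏int : ∀ m {x x'} → weight x ≤ c + m → DescendingOption A weight c Q x x' →
                   x' AG.⧏ intGame (+ m)
      option⧏int m     bound (inj₂ (x'' , r , stuck)) = AG.lfR x'' r (LeftStuck⇒≤int m stuck)
      option⧏int zero  bound (inj₁ (q' , lower , above)) =
        ⊥-elim (≤⇒≯ above (<-≤-trans lower (≤-trans bound (≤-reflexive (+-identityʳ c)))))
      option⧏int (suc m) bound (inj₁ (q' , lower , above)) =
        AG.lfL _ (here refl)
          (≤int-byWeight m q' (≤-pred (<-≤-trans lower (≤-trans bound (≤-reflexive (+-suc c m))))))

  module _ (rightStuck : ∀ {x} → Q x → RightStuck A x)
           (descend : ∀ {x} → Q x → suc c ≤ weight x →
                      ∃ λ x' → _⟶L_ A x x' × Q x' × suc (weight x') ≡ weight x) where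
    int≤-byWeight : ∀ m {x} → Q x → weight x ≡ c + m → intGame (+ m) GA.≤G x
    int≤-byWeight m q w≡ = GA.le (left m q w≡) (λ _ r → ⊥-elim (rightStuck q r))
      where
      left : ∀ m {x} → Q x → weight x ≡ c + m → ∀ g → _⟶L_ GameArena (intGame (+ m)) g → g GA.⧏ x
      left (suc m) q w≡ _ (here refl) =
        let w≡′ = trans w≡ (+-suc c m)
            x' , l , q' , step = descend q (subst (suc c ≤_) (sym w≡′) (s≤s (m≤m+n c m)))
        in GA.lfL x' l (int≤-byWeight m q' (suc-injective (trans step w≡′)))

slide-weight : ∀ {x k} l → k ≤ x → k + (3 * (x ∸ k) + 2 * (l + k)) ≡ 3 * x + 2 * l
slide-weight {x} {k} l k≤x = begin
  k + (3 * (x ∸ k) + 2 * (l + k)) ≡⟨ regroup (x ∸ k) k l ⟩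
  3 * (x ∸ k + k) + 2 * l         ≡⟨ cong (λ y → 3 * y + 2 * l) (m∸n+n≡m k≤x) ⟩
  3 * x + 2 * l                   ∎
  where
  open ≡-Reasoning
  regroup : ∀ y k l → k + (3 * y + 2 * (l + k)) ≡ 3 * (y + k) + 2 * l
  regroup = solve-∀

slide-lowers-weight : ∀ {x k} l → 1 ≤ k → k ≤ x → 3 * (x ∸ k) + 2 * (l + k) < 3 * x + 2 * l
slide-lowers-weight {x} {k} l 1≤k k≤x =
  subst (3 * (x ∸ k) + 2 * (l + k) <_) (slide-weight l k≤x) (m<n+m _ 1≤k)

jump-weight : ∀ x l → suc (3 * suc x + 2 * l) ≡ 3 * x + 2 * (2 + l)
jump-weight = solve-∀

weight-mono : ∀ {a b} x l → a ≤ x → b ≤ l → 3 * a + 2 * b ≤ 3 * x + 2 * l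
weight-mono _ _ a≤x b≤l = +-mono-≤ (*-monoʳ-≤ 3 a≤x) (*-monoʳ-≤ 2 b≤l)

sum-tabulate : ∀ {k} (f : Fin k → ℕ) → sum (tabulate f) ≡ ∑ f
sum-tabulate {zero}  f = refl
sum-tabulate {suc k} f = cong (_+_ (f zero)) (sum-tabulate (f ∘ suc))

sum-map-allFin : ∀ {k} (f : Fin k → ℕ) → sum (map f (allFin k)) ≡ ∑ f
sum-map-allFin f = trans (cong sum (map-tabulate id f)) (sum-tabulate f)

∑-update : ∀ {k} {f g : Fin (suc k) → ℕ} i {d} →
           g i ≡ f i + d → (∀ j → j ≢ i → g j ≡ f j) → ∑ g ≡ ∑ f + d
∑-update {f = f} {g} i {d} gᵢ≡ elsewhere = begin
  ∑ g                         ≡⟨ sum-remove {i = i} g ⟩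
  g i + ∑ (g ∘ punchIn i)     ≡⟨ cong₂ _+_ gᵢ≡ (sum-cong-≗ λ j → elsewhere (punchIn i j) (punchInᵢ≢i i j)) ⟩
  f i + d + ∑ (f ∘ punchIn i) ≡⟨ exchange (f i) d _ ⟩
  f i + ∑ (f ∘ punchIn i) + d ≡⟨ cong (_+ d) (sum-remove {i = i} f) ⟨
  ∑ f + d                     ∎
  where
  open ≡-Reasoning
  exchange : ∀ a d r → a + d + r ≡ a + r + d
  exchange = solve-∀

∑-positive-term : ∀ {k} (f : Fin k → ℕ) → 1 ≤ ∑ f → ∃ λ i → 1 ≤ f i
∑-positive-term {suc k} f 1≤∑ with f zero in f₀≡
... | suc _ = zero , subst (1 ≤_) (sym f₀≡) (s≤s z≤n)
... | zero  = let i , 1≤fᵢ = ∑-positive-term (f ∘ suc) 1≤∑ in suc i , 1≤fᵢ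

adjust-same : ∀ {k} (f : Fin k → ℕ) v g → adjust f v g v ≡ g (f v)
adjust-same f v g rewrite dec-true (v ≟ v) refl = refl

adjust-other : ∀ {k} (f : Fin k → ℕ) {v} g {u} → u ≢ v → adjust f v g u ≡ f u
adjust-other f {v} g {u} u≢v rewrite dec-false (u ≟ v) u≢v = refl

minus-ℤ : ∀ {n c m} → n ≡ c + m → + n -ℤ + c ≡ + m
minus-ℤ {c = c} {m} refl =
  trans (m-n≡m⊖n (c + m) c) (trans (⊖-≥ (m≤m+n c m)) (cong +_ (m+n∸m≡n c m)))

negMinus-ℤ : ∀ {n c m} → n ≡ c + m → -ℤ (+ n) +ℤ + c ≡ -ℤ (+ m)
negMinus-ℤ {c = c} {m} refl =
  trans (-m+n≡n⊖m (c + m) c) (trans (⊖-≤ (m≤m+n c m)) (cong (λ k → -ℤ (+ k)) (m+n∸m≡n c m)))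

weight-ℤ : ∀ a b c {m} → 3 * a + 2 * b ≡ c + m → + 3 *ℤ + a +ℤ + 2 *ℤ + b -ℤ + c ≡ + m
weight-ℤ a b c w≡ =
  trans (cong (_-ℤ + c) (trans (cong₂ _+ℤ_ (sym (pos-* 3 a)) (sym (pos-* 2 b))) (sym (pos-+ (3 * a) (2 * b)))))
        (minus-ℤ w≡)

double-ℤ : ∀ a c {m} → 2 * a ≡ c + m → + 2 *ℤ + a -ℤ + c ≡ + m
double-ℤ a c e = trans (cong (_-ℤ + c) (sym (pos-* 2 a))) (minus-ℤ e)

negDouble-ℤ : ∀ b c {m} → 2 * b ≡ c + m → -ℤ (+ 2 *ℤ + b) +ℤ + c ≡ -ℤ (+ m)
negDouble-ℤ b c e = trans (cong (λ z → -ℤ z +ℤ + c) (sym (pos-* 2 b))) (negMinus-ℤ e)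

record Config : Set where
  constructor config
  field
    centreBlue centreRed leaf₁Blue leaf₁Red leaf₂Blue leaf₂Red : ℕ
open Config

data Left₂ : Config → Config → Set where
  slide₁ : ∀ {x y p q s t} k → 1 ≤ k → k ≤ x → q ≡ 0 →
           Left₂ (config x y p q s t) (config (x ∸ k) y (p + k) q s t)
  slide₂ : ∀ {x y p q s t} k → 1 ≤ k → k ≤ x → t ≡ 0 →
           Left₂ (config x y p q s t) (config (x ∸ k) y p q (s + k) t)
  jump₁  : ∀ {x y p q s t} → 2 ≤ p → y ≡ 0 → Left₂ (config x y p q s t) (config (suc x) y (p ∸ 2) q s t)
  jump₂  : ∀ {x y p q s t} → 2 ≤ s → y ≡ 0 → Left₂ (config x y p q s t) (config (suc x) y p q (s ∸ 2) t)

data Right₂ : Config → Config → Set where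
  slide₁ : ∀ {x y p q s t} k → 1 ≤ k → k ≤ y → p ≡ 0 →
           Right₂ (config x y p q s t) (config x (y ∸ k) p (q + k) s t)
  slide₂ : ∀ {x y p q s t} k → 1 ≤ k → k ≤ y → s ≡ 0 →
           Right₂ (config x y p q s t) (config x (y ∸ k) p q s (t + k))
  jump₁  : ∀ {x y p q s t} → 2 ≤ q → x ≡ 0 → Right₂ (config x y p q s t) (config x (suc y) p (q ∸ 2) s t)
  jump₂  : ∀ {x y p q s t} → 2 ≤ t → x ≡ 0 → Right₂ (config x y p q s t) (config x (suc y) p q s (t ∸ 2))

TwoLeaf : Arena
TwoLeaf = record { Pos = Config ; _⟶L_ = Left₂ ; _⟶R_ = Right₂ }

configOf : Pebbles 3 → Config
configOf b = config (blue b 0F) (red b 0F) (blue b 1F) (red b 1F) (blue b 2F) (red b 2F)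

pebbles-bisimulation : Bisimulation TwoLeaf (PebbleArena (InStar 2))
pebbles-bisimulation = record
  { _∼_ = λ c b → c ≡ configOf b ; forthL = forthL ; backL = backL ; forthR = forthR ; backR = backR }
  where
  forthL : ∀ {c b c'} → c ≡ configOf b → Left₂ c c' → ∃ λ b' → LeftMove (InStar 2) b b' × c' ≡ configOf b'
  forthL {b = b} refl (slide₁ k 1≤k k≤x q≡0) = _ , slide b 0F 1F k (leaf→centre 0F) 1≤k k≤x q≡0 , refl
  forthL {b = b} refl (slide₂ k 1≤k k≤x t≡0) = _ , slide b 0F 2F k (leaf→centre 1F) 1≤k k≤x t≡0 , refl
  forthL {b = b} refl (jump₁ 2≤p y≡0)        = _ , jump b 1F 0F (leaf→centre 0F) 2≤p y≡0 , refl
  forthL {b = b} refl (jump₂ 2≤s y≡0)        = _ , jump b 2F 0F (leaf→centre 1F) 2≤s y≡0 , refl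
  backL : ∀ {c b b'} → c ≡ configOf b → LeftMove (InStar 2) b b' → ∃ λ c' → Left₂ c c' × c' ≡ configOf b'
  backL refl (slide _ _ _ k (leaf→centre 0F) 1≤k k≤x q≡0) = _ , slide₁ k 1≤k k≤x q≡0 , refl
  backL refl (slide _ _ _ k (leaf→centre 1F) 1≤k k≤x t≡0) = _ , slide₂ k 1≤k k≤x t≡0 , refl
  backL refl (jump _ _ _ (leaf→centre 0F) 2≤p y≡0)         = _ , jump₁ 2≤p y≡0 , refl
  backL refl (jump _ _ _ (leaf→centre 1F) 2≤s y≡0)         = _ , jump₂ 2≤s y≡0 , refl
  forthR : ∀ {c b c'} → c ≡ configOf b → Right₂ c c' → ∃ λ b' → RightMove (InStar 2) b b' × c' ≡ configOf b'
  forthR {b = b} refl (slide₁ k 1≤k k≤y p≡0) = _ , slide b 0F 1F k (leaf→centre 0F) 1≤k k≤y p≡0 , refl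
  forthR {b = b} refl (slide₂ k 1≤k k≤y s≡0) = _ , slide b 0F 2F k (leaf→centre 1F) 1≤k k≤y s≡0 , refl
  forthR {b = b} refl (jump₁ 2≤q x≡0)        = _ , jump b 1F 0F (leaf→centre 0F) 2≤q x≡0 , refl
  forthR {b = b} refl (jump₂ 2≤t x≡0)        = _ , jump b 2F 0F (leaf→centre 1F) 2≤t x≡0 , refl
  backR : ∀ {c b b'} → c ≡ configOf b → RightMove (InStar 2) b b' → ∃ λ c' → Right₂ c c' × c' ≡ configOf b'
  backR refl (slide _ _ _ k (leaf→centre 0F) 1≤k k≤y p≡0) = _ , slide₁ k 1≤k k≤y p≡0 , refl
  backR refl (slide _ _ _ k (leaf→centre 1F) 1≤k k≤y s≡0) = _ , slide₂ k 1≤k k≤y s≡0 , refl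
  backR refl (jump _ _ _ (leaf→centre 0F) 2≤q x≡0)         = _ , jump₁ 2≤q x≡0 , refl
  backR refl (jump _ _ _ (leaf→centre 1F) 2≤t x≡0)         = _ , jump₂ 2≤t x≡0 , refl

pos2-value : ∀ {x y p q s t g} → Equiv TwoLeaf GameArena (config x y p q s t) g →
             HasValue (InStar 2) (pos2 x y p q s t) g
pos2-value = Equiv-transport pebbles-bisimulation refl

mirror : Config → Config
mirror c = config (centreRed c) (centreBlue c) (leaf₂Red c) (leaf₂Blue c) (leaf₁Red c) (leaf₁Blue c)

mirror-Left₂ : ∀ {c c'} → Left₂ c c' → Right₂ (mirror c) (mirror c')
mirror-Left₂ (slide₁ k 1≤k k≤x q≡0) = slide₂ k 1≤k k≤x q≡0
mirror-Left₂ (slide₂ k 1≤k k≤x t≡0) = slide₁ k 1≤k k≤x t≡0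
mirror-Left₂ (jump₁ 2≤p y≡0)        = jump₂ 2≤p y≡0
mirror-Left₂ (jump₂ 2≤s y≡0)        = jump₁ 2≤s y≡0

mirror-Right₂ : ∀ {c c'} → Right₂ c c' → Left₂ (mirror c) (mirror c')
mirror-Right₂ (slide₁ k 1≤k k≤y p≡0) = slide₂ k 1≤k k≤y p≡0
mirror-Right₂ (slide₂ k 1≤k k≤y s≡0) = slide₁ k 1≤k k≤y s≡0
mirror-Right₂ (jump₁ 2≤q x≡0)        = jump₂ 2≤q x≡0
mirror-Right₂ (jump₂ 2≤t x≡0)        = jump₁ 2≤t x≡0

mirror-bisimulation : Bisimulation (Swap TwoLeaf) TwoLeaf
mirror-bisimulation = record
  { _∼_    = λ c c̃ → c̃ ≡ mirror c
  ; forthL = λ { refl r → _ , mirror-Right₂ r , refl }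
  ; backL  = λ { refl l → _ , mirror-Left₂ l , refl }
  ; forthR = λ { refl l → _ , mirror-Left₂ l , refl }
  ; backR  = λ { refl r → _ , mirror-Right₂ r , refl }
  }

mirror-value : ∀ {c} m → Equiv TwoLeaf GameArena c (intGame (+ m)) →
               Equiv TwoLeaf GameArena (mirror c) (intGame (-ℤ + m))
mirror-value m c≡m = Equiv-transport mirror-bisimulation refl (negate-value m c≡m)

redCentre-LeftStuck : ∀ {y p q s t} → LeftStuck TwoLeaf (config 0 (suc y) p q s t)
redCentre-LeftStuck (slide₁ _ (s≤s _) () _)
redCentre-LeftStuck (slide₂ _ (s≤s _) () _)
redCentre-LeftStuck (jump₁ _ ())
redCentre-LeftStuck (jump₂ _ ())

blueCentre-RightStuck : ∀ {x p q s t} → RightStuck TwoLeaf (config (suc x) 0 p q s t)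
blueCentre-RightStuck (slide₁ _ (s≤s _) () _)
blueCentre-RightStuck (slide₂ _ (s≤s _) () _)
blueCentre-RightStuck (jump₁ _ ())
blueCentre-RightStuck (jump₂ _ ())

weight₂ : Config → ℕ
weight₂ c = 3 * centreBlue c + 2 * leaf₁Blue c

data AgainstRedPair : Config → Set where
  againstRedPair : ∀ {x p t} → 1 ≤ x → 2 ≤ t → AgainstRedPair (config x 0 p 0 0 t)

redPair-leftMove : ∀ {c c'} → AgainstRedPair c → Left₂ c c' →
                   DescendingOption TwoLeaf weight₂ 5 AgainstRedPair c c'
redPair-leftMove {config x _ p _ _ _} (againstRedPair _ 2≤t) (slide₁ k 1≤k k≤x refl) with x ∸ k in x∸k≡
... | zero  = inj₂ (_ , jump₂ 2≤t refl , redCentre-LeftStuck)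
... | suc d = inj₁ ( againstRedPair (s≤s z≤n) 2≤t
                   , subst (λ y → 3 * y + 2 * (p + k) < 3 * x + 2 * p) x∸k≡
                       (slide-lowers-weight {x} p 1≤k k≤x)
                   , weight-mono (suc d) (p + k) (s≤s z≤n) (≤-trans 1≤k (m≤n+m k p)) )
redPair-leftMove (againstRedPair _ ()) (slide₂ _ _ _ refl)
redPair-leftMove {config x _ (suc (suc p)) _ _ _} (againstRedPair 1≤x 2≤t) (jump₁ (s≤s (s≤s _)) refl) =
  inj₁ ( againstRedPair (s≤s z≤n) 2≤t
       , ≤-reflexive (jump-weight x p)
       , ≤-trans (n≤1+n 5) (weight-mono (suc x) p (s≤s 1≤x) z≤n) )
redPair-leftMove (againstRedPair _ _) (jump₂ () _)

redPair-rightStuck : ∀ {c} → AgainstRedPair c → RightStuck TwoLeaf c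
redPair-rightStuck (againstRedPair (s≤s _) _) = blueCentre-RightStuck

redPair-descend : ∀ {c} → AgainstRedPair c → 6 ≤ weight₂ c →
                  ∃ λ c' → Left₂ c c' × AgainstRedPair c' × suc (weight₂ c') ≡ weight₂ c
redPair-descend {config x _ (suc (suc p)) _ _ _} (againstRedPair _ 2≤t) _ =
  _ , jump₁ (s≤s (s≤s z≤n)) refl , againstRedPair (s≤s z≤n) 2≤t , jump-weight x p
redPair-descend {config (suc (suc x)) _ p _ _ _} (againstRedPair _ 2≤t) _ =
  _ , slide₁ 1 (s≤s z≤n) (s≤s z≤n) refl , againstRedPair (s≤s z≤n) 2≤t ,
  slide-weight {suc (suc x)} p (s≤s z≤n)
redPair-descend {config (suc zero) _ zero _ _ _}       _ (s≤s (s≤s (s≤s ())))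
redPair-descend {config (suc zero) _ (suc zero) _ _ _} _ (s≤s (s≤s (s≤s (s≤s (s≤s ())))))

redPair-value : ∀ {x p t} m → 1 ≤ x → 2 ≤ t → 3 * x + 2 * p ≡ 5 + m →
                Equiv TwoLeaf GameArena (config x 0 p 0 0 t) (intGame (+ m))
redPair-value m 1≤x 2≤t w≡ =
  ≤int-byWeight weight₂ 5 redPair-leftMove m (againstRedPair 1≤x 2≤t) (≤-reflexive w≡) ,
  int≤-byWeight weight₂ 5 redPair-rightStuck redPair-descend m (againstRedPair 1≤x 2≤t) w≡

data AgainstRedSingle : Config → Set where
  againstRedSingle : ∀ {x p} → AgainstRedSingle (config x 0 p 0 0 1)

redSingle-leftMove : ∀ {c c'} → AgainstRedSingle c → Left₂ c c' →
                     DescendingOption TwoLeaf weight₂ 2 AgainstRedSingle c c'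
redSingle-leftMove {config x _ p _ _ _} againstRedSingle (slide₁ k 1≤k k≤x refl) =
  inj₁ ( againstRedSingle
       , slide-lowers-weight {x} p 1≤k k≤x
       , weight-mono (x ∸ k) (p + k) z≤n (≤-trans 1≤k (m≤n+m k p)) )
redSingle-leftMove againstRedSingle (slide₂ _ _ _ ())
redSingle-leftMove {config x _ (suc (suc p)) _ _ _} againstRedSingle (jump₁ (s≤s (s≤s _)) refl) =
  inj₁ ( againstRedSingle
       , ≤-reflexive (jump-weight x p)
       , ≤-trans (n≤1+n 2) (weight-mono (suc x) p (s≤s z≤n) z≤n) )
redSingle-leftMove againstRedSingle (jump₂ () _)

redSingle-rightStuck : ∀ {c} → AgainstRedSingle c → RightStuck TwoLeaf c
redSingle-rightStuck againstRedSingle (slide₁ _ (s≤s _) () _)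
redSingle-rightStuck againstRedSingle (slide₂ _ (s≤s _) () _)
redSingle-rightStuck againstRedSingle (jump₁ () _)
redSingle-rightStuck againstRedSingle (jump₂ (s≤s ()) _)

redSingle-descend : ∀ {c} → AgainstRedSingle c → 3 ≤ weight₂ c →
                    ∃ λ c' → Left₂ c c' × AgainstRedSingle c' × suc (weight₂ c') ≡ weight₂ c
redSingle-descend {config x _ (suc (suc p)) _ _ _} againstRedSingle _ =
  _ , jump₁ (s≤s (s≤s z≤n)) refl , againstRedSingle , jump-weight x p
redSingle-descend {config (suc x) _ p _ _ _} againstRedSingle _ =
  _ , slide₁ 1 (s≤s z≤n) (s≤s z≤n) refl , againstRedSingle , slide-weight {suc x} p (s≤s z≤n)
redSingle-descend {config zero _ zero _ _ _}       againstRedSingle ()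
redSingle-descend {config zero _ (suc zero) _ _ _} againstRedSingle (s≤s (s≤s ()))

redSingle-value : ∀ {x p} m → 3 * x + 2 * p ≡ 2 + m →
                  Equiv TwoLeaf GameArena (config x 0 p 0 0 1) (intGame (+ m))
redSingle-value m w≡ =
  ≤int-byWeight weight₂ 2 redSingle-leftMove m againstRedSingle (≤-reflexive w≡) ,
  int≤-byWeight weight₂ 2 redSingle-rightStuck redSingle-descend m againstRedSingle w≡

private
  module TG = Compare TwoLeaf GameArena
  module GT = Compare GameArena TwoLeaf

singletons-value₂ : Equiv TwoLeaf GameArena (config 0 0 0 1 1 0) (intGame (+ 0))
singletons-value₂ =
  LeftStuck⇒≤int 0 (λ { (slide₁ _ (s≤s _) () _) ; (slide₂ _ (s≤s _) () _)
                     ; (jump₁ () _) ; (jump₂ (s≤s ()) _) }) ,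
  RightStuck⇒0≤ (λ { (slide₁ _ (s≤s _) () _) ; (slide₂ _ (s≤s _) () _)
                   ; (jump₁ (s≤s ()) _) ; (jump₂ () _) })

centreBlue-redPair-zero : Equiv TwoLeaf GameArena (config 1 0 0 2 0 0) (intGame (+ 0))
centreBlue-redPair-zero =
  TG.le (λ { _ (slide₁ _ _ _ ())
           ; _ (slide₂ _ (s≤s z≤n) (s≤s z≤n) refl) →
               TG.lfR _ (jump₁ (s≤s (s≤s z≤n)) refl)
                 (LeftStuck⇒≤int 0 redCentre-LeftStuck)
           ; _ (jump₁ () _) ; _ (jump₂ () _) })
        (λ _ ()) ,
  RightStuck⇒0≤ blueCentre-RightStuck

pairs-value₂ : Equiv TwoLeaf GameArena (config 0 0 0 2 2 0) star
pairs-value₂ =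
  unique-options-value
    (λ { (slide₁ _ (s≤s _) () _) ; (slide₂ _ (s≤s _) () _) ; (jump₁ () _)
       ; (jump₂ _ refl) → centreBlue-redPair-zero })
    (_ , jump₂ (s≤s (s≤s z≤n)) refl)
    (λ { (slide₁ _ (s≤s _) () _) ; (slide₂ _ (s≤s _) () _) ; (jump₂ () _)
       ; (jump₁ _ refl) → mirror-value 0 centreBlue-redPair-zero })
    (_ , jump₁ (s≤s (s≤s z≤n)) refl)

leafJumps-value : ∀ {p t gL gR} → 2 ≤ p → 2 ≤ t →
  Equiv TwoLeaf GameArena (config 1 0 (p ∸ 2) 0 0 t) gL → Equiv TwoLeaf GameArena (config 0 1 p 0 0 (t ∸ 2)) gR →
  Equiv TwoLeaf GameArena (config 0 0 p 0 0 t) ⟨ [ gL ] ∣ [ gR ] ⟩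
leafJumps-value 2≤p 2≤t left right =
  unique-options-value
    (λ { (slide₁ _ (s≤s _) () _) ; (slide₂ _ (s≤s _) () _) ; (jump₂ () _) ; (jump₁ _ refl) → left })
    (_ , jump₁ 2≤p refl)
    (λ { (slide₁ _ (s≤s _) () _) ; (slide₂ _ (s≤s _) () _) ; (jump₁ () _) ; (jump₂ _ refl) → right })
    (_ , jump₂ 2≤t refl)

centreRed-blueLeaf-zero : ∀ a → Equiv TwoLeaf GameArena (config 0 1 (3 + a) 0 0 0) (intGame (+ 0))
centreRed-blueLeaf-zero a =
  LeftStuck⇒≤int 0 redCentre-LeftStuck ,
  GT.le (λ _ ())
        (λ { _ (slide₁ _ _ _ ())
           ; _ (slide₂ _ (s≤s z≤n) (s≤s z≤n) refl) →
               GT.lfL _ (jump₁ (s≤s (s≤s z≤n)) refl) (RightStuck⇒0≤ (redSingle-rightStuck againstRedSingle))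
           ; _ (jump₁ () _) ; _ (jump₂ () _) })

module NoRedInStar (n : ℕ) where
  Star : Digraph (2 + n)
  Star = InStar (suc n)

  StarArena : Arena
  StarArena = PebbleArena Star

  leaves : Pebbles (2 + n) → Fin (suc n) → ℕ
  leaves p i = blue p (suc i)

  weight : Pebbles (2 + n) → ℕ
  weight p = 3 * blue p zero + 2 * leafBlue p

  NoRed : Pebbles (2 + n) → Set
  NoRed p = ∀ v → red p v ≡ 0

  afterSlide : Pebbles (2 + n) → Fin (suc n) → ℕ → Pebbles (2 + n)
  afterSlide p i k = pebbles (adjust (adjust (blue p) zero (_∸ k)) (suc i) (_+ k)) (red p)

  afterJump : Pebbles (2 + n) → Fin (suc n) → Pebbles (2 + n)
  afterJump p i = pebbles (adjust (adjust (blue p) (suc i) (_∸ 2)) zero suc) (red p)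

  leafBlue-afterSlide : ∀ p i k → leafBlue (afterSlide p i k) ≡ leafBlue p + k
  leafBlue-afterSlide p i k = begin
    leafBlue (afterSlide p i k)  ≡⟨ sum-map-allFin (leaves (afterSlide p i k)) ⟩
    ∑ (leaves (afterSlide p i k)) ≡⟨ ∑-update i (adjust-same (adjust (blue p) zero (_∸ k)) (suc i) (_+ k))
                                              elsewhere ⟩
    ∑ (leaves p) + k             ≡⟨ cong (_+ k) (sum-map-allFin (leaves p)) ⟨
    leafBlue p + k               ∎
    where
    open ≡-Reasoning
    elsewhere : ∀ j → j ≢ i → leaves (afterSlide p i k) j ≡ leaves p j
    elsewhere j j≢i = adjust-other (adjust (blue p) zero (_∸ k)) (_+ k) (j≢i ∘ Fin-suc-injective)

  leafBlue-afterJump : ∀ p i → 2 ≤ blue p (suc i) → leafBlue p ≡ 2 + leafBlue (afterJump p i)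
  leafBlue-afterJump p i 2≤bᵢ = begin
    leafBlue p                       ≡⟨ sum-map-allFin (leaves p) ⟩
    ∑ (leaves p)                     ≡⟨ ∑-update i bᵢ≡ elsewhere ⟩
    ∑ (leaves (afterJump p i)) + 2   ≡⟨ +-comm _ 2 ⟩
    2 + ∑ (leaves (afterJump p i))   ≡⟨ cong (_+_ 2) (sum-map-allFin (leaves (afterJump p i))) ⟨
    2 + leafBlue (afterJump p i)     ∎
    where
    open ≡-Reasoning
    bᵢ≡ : leaves p i ≡ leaves (afterJump p i) i + 2
    bᵢ≡ = sym (trans (cong (_+ 2) (adjust-same (blue p) (suc i) (_∸ 2))) (m∸n+n≡m 2≤bᵢ))
    elsewhere : ∀ j → j ≢ i → leaves p j ≡ leaves (afterJump p i) j
    elsewhere j j≢i = sym (adjust-other (blue p) (_∸ 2) (j≢i ∘ Fin-suc-injective))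

  weight-afterSlide : ∀ p i {k} → k ≤ blue p zero → k + weight (afterSlide p i k) ≡ weight p
  weight-afterSlide p i {k} k≤b =
    trans (cong (λ l → k + (3 * (blue p zero ∸ k) + 2 * l)) (leafBlue-afterSlide p i k))
          (slide-weight (leafBlue p) k≤b)

  weight-afterJump : ∀ p i → 2 ≤ blue p (suc i) → suc (weight (afterJump p i)) ≡ weight p
  weight-afterJump p i 2≤bᵢ =
    trans (jump-weight (blue p zero) _)
          (cong (λ l → 3 * blue p zero + 2 * l) (sym (leafBlue-afterJump p i 2≤bᵢ)))

  noRed-leftMove : ∀ {p p'} → ⊤ → LeftMove Star p p' → DescendingOption StarArena weight 2 (λ _ → ⊤) p p'
  noRed-leftMove _ (slide p _ _ k (leaf→centre i) 1≤k k≤b _) = inj₁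
    ( tt
    , subst (weight (afterSlide p i k) <_) (weight-afterSlide p i k≤b) (m<n+m _ 1≤k)
    , weight-mono (blue p zero ∸ k) (leafBlue (afterSlide p i k)) z≤n 1≤Lb′ )
    where
    1≤Lb′ : 1 ≤ leafBlue (afterSlide p i k)
    1≤Lb′ = subst (1 ≤_) (sym (leafBlue-afterSlide p i k)) (≤-trans 1≤k (m≤n+m k _))
  noRed-leftMove _ (jump p _ _ (leaf→centre i) 2≤bᵢ _) = inj₁
    ( tt
    , ≤-reflexive (weight-afterJump p i 2≤bᵢ)
    , ≤-trans (n≤1+n 2) (weight-mono (suc (blue p zero)) (leafBlue (afterJump p i)) (s≤s z≤n) z≤n) )

  noRed-rightStuck : ∀ {p} → NoRed p → RightStuck StarArena p
  noRed-rightStuck noRed (slide _ v _ k _ 1≤k k≤r _) =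
    contradiction (≤-trans 1≤k (subst (k ≤_) (noRed v) k≤r)) λ ()
  noRed-rightStuck noRed (jump _ v _ _ 2≤r _) =
    contradiction (subst (2 ≤_) (noRed v) 2≤r) λ ()

  -- Excludes e.g. one blue pebble on each of two leaves and none on the centre: weight 4, but Left cannot move.
  data Unblocked (p : Pebbles (2 + n)) : Set where
    centreOccupied : 1 ≤ blue p zero → Unblocked p
    leafPair       : ∀ i → 2 ≤ blue p (suc i) → Unblocked p
    leavesSparse   : leafBlue p ≤ 1 → Unblocked p

  unblocked⇒centreOccupied : ∀ {p} → Unblocked p → ¬ (∃ λ i → 2 ≤ blue p (suc i)) → 3 ≤ weight p →
                             1 ≤ blue p zero
  unblocked⇒centreOccupied (centreOccupied 1≤b)   _      _   = 1≤b
  unblocked⇒centreOccupied (leafPair i 2≤bᵢ)      noPair _   = contradiction (i , 2≤bᵢ) noPair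
  unblocked⇒centreOccupied {p} (leavesSparse Lb≤1) _     3≤w with 1 ≤? blue p zero
  ... | yes 1≤b = 1≤b
  ... | no  1≰b = contradiction 3≤w (≤⇒≯ (weight-mono 0 1 (≤-reflexive (n<1⇒n≡0 (≰⇒> 1≰b))) Lb≤1))

  slide-one : ∀ {p} → NoRed p → 1 ≤ blue p zero →
              ∃ λ p' → LeftMove Star p p' × (NoRed p' × Unblocked p') × suc (weight p') ≡ weight p
  slide-one {p} noRed 1≤b with 1 ≤? leafBlue p
  ... | yes 1≤Lb =
    let i , 1≤bᵢ = ∑-positive-term (leaves p) (subst (1 ≤_) (sum-map-allFin (leaves p)) 1≤Lb)
        2≤bᵢ′ = subst (2 ≤_) (sym (adjust-same (adjust (blue p) zero (_∸ 1)) (suc i) (_+ 1)))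
                      (+-monoˡ-≤ 1 1≤bᵢ)
    in afterSlide p i 1 , slide p zero (suc i) 1 (leaf→centre i) (s≤s z≤n) 1≤b (noRed (suc i)) ,
       (noRed , leafPair i 2≤bᵢ′) , weight-afterSlide p i 1≤b
  ... | no 1≰Lb =
    let Lb′≤1 = ≤-reflexive (trans (leafBlue-afterSlide p zero 1) (cong (_+ 1) (n<1⇒n≡0 (≰⇒> 1≰Lb))))
    in afterSlide p zero 1 , slide p zero (suc zero) 1 (leaf→centre zero) (s≤s z≤n) 1≤b (noRed (suc zero)) ,
       (noRed , leavesSparse Lb′≤1) , weight-afterSlide p zero 1≤b

  noRed-descend : ∀ {p} → NoRed p × Unblocked p → 3 ≤ weight p →
                  ∃ λ p' → LeftMove Star p p' × (NoRed p' × Unblocked p') × suc (weight p') ≡ weight p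
  noRed-descend {p} (noRed , unblocked) 3≤w with any? (λ i → 2 ≤? blue p (suc i))
  ... | yes (i , 2≤bᵢ) = afterJump p i , jump p (suc i) zero (leaf→centre i) 2≤bᵢ (noRed zero) ,
                         (noRed , centreOccupied (s≤s z≤n)) , weight-afterJump p i 2≤bᵢ
  ... | no noPair      = slide-one noRed (unblocked⇒centreOccupied unblocked noPair 3≤w)

  noRed-value : ∀ {p} m → NoRed p → 1 ≤ blue p zero → weight p ≡ 2 + m →
                Equiv StarArena GameArena p (intGame (+ m))
  noRed-value m noRed 1≤b w≡ =
    ≤int-byWeight weight 2 noRed-leftMove m tt (≤-reflexive w≡) ,
    int≤-byWeight weight 2 (noRed-rightStuck ∘ proj₁) noRed-descend m (noRed , centreOccupied 1≤b) w≡

noRed-inStar-value : ∀ (k : ℕ) (p : Pebbles (suc k)) →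
  (∀ v → red p v ≡ 0) → 1 ≤ blue p zero → 1 ≤ leafBlue p →
  HasValue (InStar k) p (intGame (+ 3 *ℤ + blue p zero +ℤ + 2 *ℤ + leafBlue p -ℤ + 2))
noRed-inStar-value zero    p _     _   ()
noRed-inStar-value (suc n) p noRed 1≤b _ =
  subst (HasValue (InStar (suc n)) p ∘ intGame) (sym (weight-ℤ (blue p zero) (leafBlue p) 2 w≡))
        (noRed-value _ noRed 1≤b w≡)
  where
  open NoRedInStar n
  w≡ : weight p ≡ 2 + (weight p ∸ 2)
  w≡ = sym (m+[n∸m]≡n (≤-trans (n≤1+n 2) (weight-mono (blue p zero) (leafBlue p) 1≤b z≤n)))

unit-centre-weight : ∀ a → 3 * 1 + 2 * suc a ≡ 5 + 2 * a
unit-centre-weight = solve-∀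

double-minus-two : ∀ a → 2 * (2 + a) ≡ 2 + 2 * suc a
double-minus-two = solve-∀

double-minus-six : ∀ a → 2 * (3 + a) ≡ 6 + 2 * a
double-minus-six = solve-∀

weight-minus-five : ∀ a b → 3 * suc a + 2 * suc b ≡ 5 + (3 * a + 2 * b)
weight-minus-five = solve-∀

blueLeaf-redSingleton-value : ∀ (a : ℕ) → 2 ≤ a →
  HasValue (InStar 2) (pos2 0 0 a 0 0 1) (intGame (+ 2 *ℤ + a -ℤ + 2))
blueLeaf-redSingleton-value (suc (suc a)) (s≤s (s≤s z≤n)) =
  subst (HasValue (InStar 2) (pos2 0 0 (2 + a) 0 0 1) ∘ intGame)
        (sym (double-ℤ (2 + a) 2 (double-minus-two a)))
        (pos2-value (redSingle-value (2 * suc a) (double-minus-two a)))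

blueLeaf-redPair-value : ∀ (a : ℕ) → 3 ≤ a →
  HasValue (InStar 2) (pos2 0 0 a 0 0 2) ⟨ [ intGame (+ 2 *ℤ + a -ℤ + 6) ] ∣ [ intGame (+ 0) ] ⟩
blueLeaf-redPair-value (suc (suc (suc a))) (s≤s (s≤s (s≤s z≤n))) =
  subst (λ z → HasValue (InStar 2) (pos2 0 0 (3 + a) 0 0 2) ⟨ [ intGame z ] ∣ [ intGame (+ 0) ] ⟩)
        (sym (double-ℤ (3 + a) 6 (double-minus-six a)))
        (pos2-value (leafJumps-value (s≤s (s≤s z≤n)) (s≤s (s≤s z≤n))
          (redPair-value (2 * a) (s≤s z≤n) (s≤s (s≤s z≤n)) (unit-centre-weight a))
          (centreRed-blueLeaf-zero a)))

blueLeaf-redLeaf-value : ∀ (a b : ℕ) → 3 ≤ a → 3 ≤ b →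
  HasValue (InStar 2) (pos2 0 0 a 0 0 b)
    ⟨ [ intGame (+ 2 *ℤ + a -ℤ + 6) ] ∣ [ intGame (-ℤ (+ 2 *ℤ + b) +ℤ + 6) ] ⟩
blueLeaf-redLeaf-value (suc (suc (suc a))) (suc (suc (suc b))) (s≤s (s≤s (s≤s z≤n))) (s≤s (s≤s (s≤s z≤n))) =
  subst₂ (λ z z' → HasValue (InStar 2) (pos2 0 0 (3 + a) 0 0 (3 + b)) ⟨ [ intGame z ] ∣ [ intGame z' ] ⟩)
         (sym (double-ℤ (3 + a) 6 (double-minus-six a))) (sym (negDouble-ℤ (3 + b) 6 (double-minus-six b)))
         (pos2-value (leafJumps-value (s≤s (s≤s z≤n)) (s≤s (s≤s z≤n))
           (redPair-value (2 * a) (s≤s z≤n) (s≤s (s≤s z≤n)) (unit-centre-weight a))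
           (mirror-value (2 * b) (redPair-value (2 * b) (s≤s z≤n) (s≤s (s≤s z≤n)) (unit-centre-weight b)))))

blueCentre-value : ∀ (a b c : ℕ) → 1 ≤ a → 1 ≤ b → 2 ≤ c →
  HasValue (InStar 2) (pos2 a 0 b 0 0 c) (intGame (+ 3 *ℤ + a +ℤ + 2 *ℤ + b -ℤ + 5))
blueCentre-value (suc a) (suc b) c (s≤s z≤n) (s≤s z≤n) 2≤c =
  subst (HasValue (InStar 2) (pos2 (suc a) 0 (suc b) 0 0 c) ∘ intGame)
        (sym (weight-ℤ (suc a) (suc b) 5 (weight-minus-five a b)))
        (pos2-value (redPair-value (3 * a + 2 * b) (s≤s z≤n) 2≤c (weight-minus-five a b)))

theorem4 :
    -- (1) any in-star, no red pebbles, b_c ≥ 1, b_ℓ ≥ 1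
    (∀ (k : ℕ) (p : Pebbles (ℕ.suc k)) →
       (∀ v → red p v ≡ 0) → 1 ≤ blue p zero → 1 ≤ leafBlue p →
       HasValue (InStar k) p
         (intGame (+ 3 *ℤ + blue p zero +ℤ + 2 *ℤ + leafBlue p -ℤ + 2)))
    -- (2)
    × HasValue (InStar 2) (pos2 0 0 0 1 1 0) (intGame (+ 0))
    × HasValue (InStar 2) (pos2 0 0 0 2 2 0) star
    -- (3)
    × (∀ (a : ℕ) → 2 ≤ a →
         HasValue (InStar 2) (pos2 0 0 a 0 0 1) (intGame (+ 2 *ℤ + a -ℤ + 2)))
    -- (4)
    × (∀ (a : ℕ) → 3 ≤ a →
         HasValue (InStar 2) (pos2 0 0 a 0 0 2)
           ⟨ [ intGame (+ 2 *ℤ + a -ℤ + 6) ] ∣ [ intGame (+ 0) ] ⟩)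
    -- (5)
    × (∀ (a b : ℕ) → 3 ≤ a → 3 ≤ b →
         HasValue (InStar 2) (pos2 0 0 a 0 0 b)
           ⟨ [ intGame (+ 2 *ℤ + a -ℤ + 6) ] ∣ [ intGame (-ℤ (+ 2 *ℤ + b) +ℤ + 6) ] ⟩)
    -- (6)
    × (∀ (a b c : ℕ) → 1 ≤ a → 1 ≤ b → 2 ≤ c →
         HasValue (InStar 2) (pos2 a 0 b 0 0 c)
           (intGame (+ 3 *ℤ + a +ℤ + 2 *ℤ + b -ℤ + 5)))
theorem4 =
  noRed-inStar-value ,
  pos2-value singletons-value₂ ,
  pos2-value pairs-value₂ ,
  blueLeaf-redSingleton-value ,
  blueLeaf-redPair-value ,
  blueLeaf-redLeaf-value ,
  blueCentre-value
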